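{- Let $\sigma$ be the morphism on $\{a,b,c\}$ defined by $\sigma(a)=acaba$, $\sigma(b)=bac$, $\sigma(c)=cab$. Then the iterative fixed point of $\sigma$ beginning with $a$ is $4$-automatic (hence $2$-automatic).
   Context: A sequence is $q$-automatic if it is the image under a letter-to-letter map of a fixed point of a morphism all of whose images have length $q$. -}

module Defs where

open import Data.Nat using (ℕ; zero; suc)
open import Data.Fin using (Fin)
open import Data.List using (List; []; _∷_; map; concatMap; length; take; upTo)
open import Data.Vec using (Vec; toList)
open import Data.Product using (Σ; ∃; _×_; _,_)
open import Relation.Binary.PropositionalEquality using (_≡_)

-- Infinite words over A are sequences ℕ → A.
-- A morphism of the free monoid is given by the images of the letters.
Morphism : Set → Set
Morphism A = A → List A

apply : {A : Set} → Morphism A → List A → List A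
apply σ w = concatMap σ w

prefix : {A : Set} → ℕ → (ℕ → A) → List A
prefix n x = map x (upTo n)

-- x is a fixed point of σ, i.e. σ(x) = x as infinite words:
-- for every n, σ(x₀…x_{n-1}) is a prefix of x.
IsFixedPoint : {A : Set} → Morphism A → (ℕ → A) → Set
IsFixedPoint σ x =
  ∀ n → prefix (length (apply σ (prefix n x))) x ≡ apply σ (prefix n x)

data Letter : Set where
  a b c : Letter

σ : Morphism Letter
σ a = a ∷ c ∷ a ∷ b ∷ a ∷ []
σ b = b ∷ a ∷ c ∷ []
σ c = c ∷ a ∷ b ∷ []

uniformMorphism : {m q : ℕ} → (Fin m → Vec (Fin m) q) → Morphism (Fin m)
uniformMorphism τ i = toList (τ i)

IsAutomatic : {A : Set} → ℕ → (ℕ → A) → Set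
IsAutomatic {A} q x =
  Σ ℕ λ m →
  Σ (Fin m → Vec (Fin m) q) λ τ →
  Σ (ℕ → Fin m) λ y →
  Σ (Fin m → A) λ f →
    IsFixedPoint (uniformMorphism τ) y × (∀ i → x i ≡ f (y i))

-- Strong induction over pairs shows that x is a concatenation of the blocks ab and ac: the pair
-- at positions 2j, 2j+1 has image σ(a)σ(p) = acaba·bac or acaba·cab, which again consists of
-- such blocks and occupies the pairs 4j, …, 4j+3. Reading off these eight letters gives x(2i) = a,
-- x(4i+1) = ρ₁(x i) and x(4i+3) = ρ₃(x i), so the pair (x i, x(2i+1)) satisfies a base-2 digit
-- recurrence on nine states. A base-q recurrence y(qi+r) = δᵣ(y i) makes y a fixed point of the
-- q-uniform morphism s ↦ δ₀(s)…δ_{q-1}(s), and two base-2 digits make one base-4 digit.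
module Submission where

open import Defs
open import Data.Nat using (ℕ; zero; suc; _+_; _*_; _<_; s≤s; z≤n; NonZero)
open import Data.Nat.Properties using (+-comm; +-identityʳ; <-trans; n<1+n; m<n⇒m<1+n)
open import Data.Nat.DivMod using (_/_; _%_; m≡m%n+[m/n]*n; m%n<n; m/n<m)
open import Data.Nat.Induction using (<-rec)
open import Data.Nat.Tactic.RingSolver using (solve)
open import Data.Fin using (Fin; toℕ; combine; remQuot)
open import Data.Fin.Patterns using (0F; 1F; 2F; 3F; 4F)
open import Data.Fin.Properties using (remQuot-combine; combine-remQuot; toℕ-combine)
open import Data.List using ([]; _∷_; _++_; [_]; map; length; lookup; applyUpTo; upTo)
open import Data.List.Properties
  using (upTo-∷ʳ; map-++; concatMap-++; ++-identityʳ; map-upTo; length-applyUpTo; length-++; ∷-injectiveˡ; ∷-injectiveʳ)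
open import Data.Vec using (Vec; toList; tabulate)
open import Data.Vec.Properties using (tabulate-cong)
open import Data.Product using (_×_; _,_; proj₁; proj₂)
import Data.Product as Product
open import Data.Sum using (_⊎_; inj₁; inj₂)
open import Function using (_∘_)
open import Relation.Binary.PropositionalEquality
  using (_≡_; refl; sym; trans; cong; cong₂; subst; module ≡-Reasoning)

open ≡-Reasoning

module _ {A : Set} where

  applyUpTo-+ : ∀ (g : ℕ → A) m n → applyUpTo g (m + n) ≡ applyUpTo g m ++ applyUpTo (λ r → g (m + r)) n
  applyUpTo-+ g zero    n = refl
  applyUpTo-+ g (suc m) n = cong (g 0 ∷_) (applyUpTo-+ (g ∘ suc) m n)

  toList-tabulate-toℕ : ∀ (g : ℕ → A) n → toList (tabulate {n = n} (g ∘ toℕ)) ≡ applyUpTo g n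
  toList-tabulate-toℕ g zero    = refl
  toList-tabulate-toℕ g (suc n) = cong (g 0 ∷_) (toList-tabulate-toℕ (g ∘ suc) n)

  applyUpTo≡⇒lookup : ∀ (g : ℕ → A) w → applyUpTo g (length w) ≡ w → ∀ i → g (toℕ i) ≡ lookup w i
  applyUpTo≡⇒lookup g (_ ∷ w) eq 0F          = ∷-injectiveˡ eq
  applyUpTo≡⇒lookup g (_ ∷ w) eq (Fin.suc i) = applyUpTo≡⇒lookup (g ∘ suc) w (∷-injectiveʳ eq) i

  applyUpTo≡⇒lookup-++ʳ : ∀ (g : ℕ → A) u v → applyUpTo g (length (u ++ v)) ≡ u ++ v →
                          ∀ i → g (length u + toℕ i) ≡ lookup v i
  applyUpTo≡⇒lookup-++ʳ g []      v eq = applyUpTo≡⇒lookup g v eq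
  applyUpTo≡⇒lookup-++ʳ g (_ ∷ u) v eq = applyUpTo≡⇒lookup-++ʳ (g ∘ suc) u v (∷-injectiveʳ eq)

  apply-prefix-suc : ∀ (τ : Morphism A) n x → apply τ (prefix (suc n) x) ≡ apply τ (prefix n x) ++ τ (x n)
  apply-prefix-suc τ n x = begin
    apply τ (prefix (suc n) x)              ≡⟨ cong (apply τ ∘ map x) (upTo-∷ʳ n) ⟨
    apply τ (map x (upTo n ++ [ n ]))       ≡⟨ cong (apply τ) (map-++ x (upTo n) [ n ]) ⟩
    apply τ (prefix n x ++ [ x n ])         ≡⟨ concatMap-++ τ (prefix n x) [ x n ] ⟩
    apply τ (prefix n x) ++ (τ (x n) ++ []) ≡⟨ cong (apply τ (prefix n x) ++_) (++-identityʳ (τ (x n))) ⟩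
    apply τ (prefix n x) ++ τ (x n)         ∎

  length-apply-prefix-suc : ∀ (τ : Morphism A) n x →
    length (apply τ (prefix (suc n) x)) ≡ length (apply τ (prefix n x)) + length (τ (x n))
  length-apply-prefix-suc τ n x = trans (cong length (apply-prefix-suc τ n x)) (length-++ (apply τ (prefix n x)))

  -- τ(x₀…xₙ) = τ(x₀…xₙ₋₁) τ(xₙ) is a prefix of x.
  fixedPoint-image : ∀ {τ : Morphism A} {x} → IsFixedPoint τ x → ∀ n {p} → x n ≡ p →
    ∀ (i : Fin (length (τ p))) → x (length (apply τ (prefix n x)) + toℕ i) ≡ lookup (τ p) i
  fixedPoint-image {τ} {x} fix n refl =
    applyUpTo≡⇒lookup-++ʳ x (apply τ (prefix n x)) (τ (x n))
      (subst (λ w → applyUpTo x (length w) ≡ w) (apply-prefix-suc τ n x)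
        (trans (sym (map-upTo x _)) (fix (suc n))))

∀-by-residue : ∀ {P : ℕ → Set} q .{{_ : NonZero q}} → (∀ k s → s < q → P (s + k * q)) → ∀ n → P n
∀-by-residue {P} q h n = subst P (sym (m≡m%n+[m/n]*n n q)) (h (n / q) (n % q) (m%n<n n q))

record DigitRecurrence {S : Set} (q : ℕ) (δ : Fin q → S → S) (y : ℕ → S) : Set where
  constructor digitRecurrence
  field recurrence : ∀ i r → y (i * q + toℕ r) ≡ δ r (y i)

open DigitRecurrence

digitMorphism : ∀ {m q} → (Fin q → Fin m → Fin m) → Fin m → Vec (Fin m) q
digitMorphism δ s = tabulate (λ r → δ r s)

module _ {m q : ℕ} {δ : Fin q → Fin m → Fin m} {y : ℕ → Fin m} (rec : DigitRecurrence q δ y) where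

  private
    τ : Morphism (Fin m)
    τ = uniformMorphism (digitMorphism δ)

  apply-prefix-digitMorphism : ∀ n → apply τ (prefix n y) ≡ applyUpTo y (n * q)
  apply-prefix-digitMorphism zero    = refl
  apply-prefix-digitMorphism (suc n) = begin
    apply τ (prefix (suc n) y)                                ≡⟨ apply-prefix-suc τ n y ⟩
    apply τ (prefix n y) ++ τ (y n)                           ≡⟨ cong₂ _++_ (apply-prefix-digitMorphism n) image ⟩
    applyUpTo y (n * q) ++ applyUpTo (λ r → y (n * q + r)) q ≡⟨ applyUpTo-+ y (n * q) q ⟨
    applyUpTo y (n * q + q)                                   ≡⟨ cong (applyUpTo y) (+-comm (n * q) q) ⟩
    applyUpTo y (suc n * q)                                   ∎
    where
    image : τ (y n) ≡ applyUpTo (λ r → y (n * q + r)) q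
    image = trans (cong toList (tabulate-cong (λ r → sym (recurrence rec n r))))
                  (toList-tabulate-toℕ (λ r → y (n * q + r)) q)

  digitRecurrence⇒fixedPoint : IsFixedPoint τ y
  digitRecurrence⇒fixedPoint n = begin
    prefix (length (apply τ (prefix n y))) y  ≡⟨ cong (λ w → prefix (length w) y) (apply-prefix-digitMorphism n) ⟩
    prefix (length (applyUpTo y (n * q))) y   ≡⟨ cong (λ l → prefix l y) (length-applyUpTo y (n * q)) ⟩
    prefix (n * q) y                          ≡⟨ map-upTo y (n * q) ⟩
    applyUpTo y (n * q)                       ≡⟨ apply-prefix-digitMorphism n ⟨
    apply τ (prefix n y)                      ∎

digitRecurrence⇒isAutomatic : ∀ {S A : Set} {m q} (encode : S → Fin m) (decode : Fin m → S) →
  (∀ s → decode (encode s) ≡ s) → ∀ {δ y} → DigitRecurrence q δ y →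
  ∀ (f : S → A) {x} → (∀ i → x i ≡ f (y i)) → IsAutomatic q x
digitRecurrence⇒isAutomatic {m = m} {q} encode decode retract {δ} {y} rec f x≡fy =
  m , digitMorphism δ′ , encode ∘ y , f ∘ decode ,
  digitRecurrence⇒fixedPoint rec′ , λ i → trans (x≡fy i) (cong f (sym (retract (y i))))
  where
  δ′ : Fin q → Fin m → Fin m
  δ′ r = encode ∘ δ r ∘ decode

  rec′ : DigitRecurrence q δ′ (encode ∘ y)
  rec′ = digitRecurrence λ i r → trans (cong encode (recurrence rec i r)) (cong (encode ∘ δ r) (sym (retract (y i))))

-- The base-q² digit j stands for the base-q digits (r₁ , r₀) = remQuot q j, of value q r₁ + r₀.
squareDigits : ∀ {S : Set} {q} → (Fin q → S → S) → Fin (q * q) → S → S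
squareDigits {q = q} δ j = δ (proj₂ (remQuot {q} q j)) ∘ δ (proj₁ (remQuot {q} q j))

digitRecurrence-square : ∀ {S : Set} {q δ} {y : ℕ → S} →
  DigitRecurrence q δ y → DigitRecurrence (q * q) (squareDigits δ) y
digitRecurrence-square {q = q} {δ} {y} rec = digitRecurrence recurrence²
  where
  recurrence² : ∀ i j → y (i * (q * q) + toℕ j) ≡ squareDigits δ j (y i)
  recurrence² i j = begin
    y (i * (q * q) + toℕ j)                 ≡⟨ cong (λ j → y (i * (q * q) + toℕ j)) (combine-remQuot {q} q j) ⟨
    y (i * (q * q) + toℕ (combine r₁ r₀))   ≡⟨ cong (λ t → y (i * (q * q) + t)) (toℕ-combine r₁ r₀) ⟩
    y (i * (q * q) + (q * toℕ r₁ + toℕ r₀)) ≡⟨ cong y (digits (toℕ r₁) (toℕ r₀)) ⟩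
    y ((i * q + toℕ r₁) * q + toℕ r₀)       ≡⟨ recurrence rec (i * q + toℕ r₁) r₀ ⟩
    δ r₀ (y (i * q + toℕ r₁))               ≡⟨ cong (δ r₀) (recurrence rec i r₁) ⟩
    δ r₀ (δ r₁ (y i))                       ∎
    where
    r₁ = proj₁ (remQuot {q} q j)
    r₀ = proj₂ (remQuot {q} q j)

    digits : ∀ u v → i * (q * q) + (q * u + v) ≡ (i * q + u) * q + v
    digits u v = solve (i ∷ q ∷ u ∷ v ∷ [])

letterToFin : Letter → Fin 3
letterToFin a = 0F
letterToFin b = 1F
letterToFin c = 2F

finToLetter : Fin 3 → Letter
finToLetter 0F = a
finToLetter 1F = b
finToLetter 2F = c

finToLetter-letterToFin : ∀ u → finToLetter (letterToFin u) ≡ u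
finToLetter-letterToFin a = refl
finToLetter-letterToFin b = refl
finToLetter-letterToFin c = refl

encodePair : Letter × Letter → Fin 9
encodePair (u , v) = combine (letterToFin u) (letterToFin v)

decodePair : Fin 9 → Letter × Letter
decodePair s = Product.map finToLetter finToLetter (remQuot 3 s)

decodePair-encodePair : ∀ p → decodePair (encodePair p) ≡ p
decodePair-encodePair (u , v) = begin
  Product.map finToLetter finToLetter (remQuot 3 (combine (letterToFin u) (letterToFin v)))
    ≡⟨ cong (Product.map finToLetter finToLetter) (remQuot-combine (letterToFin u) (letterToFin v)) ⟩
  finToLetter (letterToFin u) , finToLetter (letterToFin v)
    ≡⟨ cong₂ _,_ (finToLetter-letterToFin u) (finToLetter-letterToFin v) ⟩
  u , v ∎

BC : Letter → Set
BC p = p ≡ b ⊎ p ≡ c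

length-σ-BC : ∀ {p} → BC p → length (σ p) ≡ 3
length-σ-BC (inj₁ refl) = refl
length-σ-BC (inj₂ refl) = refl

ρ₁ ρ₃ : Letter → Letter
ρ₁ a = c
ρ₁ b = b
ρ₁ c = c
ρ₃ a = b
ρ₃ b = c
ρ₃ c = b

pairStep : Fin 2 → Letter × Letter → Letter × Letter
pairStep 0F (u , v) = a , ρ₁ u
pairStep 1F (u , v) = v , ρ₃ u

module FixedPointOfσ {x : ℕ → Letter} (fix : IsFixedPoint σ x) (x0≡a : x 0 ≡ a) where

  Paired : ℕ → Set
  Paired j = x (j * 2) ≡ a × BC (x (suc (j * 2)))

  PairedBelow : ℕ → Set
  PairedBelow k = ∀ {j} → j < k → Paired j

  imageLength : ℕ → ℕ
  imageLength n = length (apply σ (prefix n x))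

  -- The position equation comes last, so that both of its sides are known when the ring solver runs.
  _at_ : ∀ {n v} → x n ≡ v → ∀ {m} → m ≡ n → x m ≡ v
  xn≡v at m≡n = trans (cong x m≡n) xn≡v

  imageLength-even : ∀ k → PairedBelow k → imageLength (k * 2) ≡ k * 8

  imageLength-odd : ∀ k → PairedBelow k → x (k * 2) ≡ a → imageLength (suc (k * 2)) ≡ k * 8 + 5
  imageLength-odd k below xa = begin
    imageLength (suc (k * 2))                    ≡⟨ length-apply-prefix-suc σ (k * 2) x ⟩
    imageLength (k * 2) + length (σ (x (k * 2))) ≡⟨ cong₂ _+_ (imageLength-even k below) (cong (length ∘ σ) xa) ⟩
    k * 8 + 5                                    ∎

  imageLength-even zero    _     = refl
  imageLength-even (suc k) below = begin
    imageLength (suc (suc (k * 2)))                          ≡⟨ length-apply-prefix-suc σ (suc (k * 2)) x ⟩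
    imageLength (suc (k * 2)) + length (σ (x (suc (k * 2)))) ≡⟨ cong₂ _+_ (imageLength-odd k below′ xa) (length-σ-BC bc) ⟩
    k * 8 + 5 + 3                                            ≡⟨ solve (k ∷ []) ⟩
    suc k * 8                                                ∎
    where
    below′ : PairedBelow k
    below′ j<k = below (m<n⇒m<1+n j<k)
    xa = proj₁ (below (n<1+n k))
    bc = proj₂ (below (n<1+n k))

  σa-at-8k : ∀ k → PairedBelow k → x (k * 2) ≡ a → ∀ i → x (k * 8 + toℕ i) ≡ lookup (σ a) i
  σa-at-8k k below xa i =
    subst (λ l → x (l + toℕ i) ≡ lookup (σ a) i) (imageLength-even k below) (fixedPoint-image fix (k * 2) xa i)

  σp-at-8k+5 : ∀ k → PairedBelow k → x (k * 2) ≡ a → ∀ {p} → x (suc (k * 2)) ≡ p →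
    ∀ i → x (k * 8 + 5 + toℕ i) ≡ lookup (σ p) i
  σp-at-8k+5 k below xa {p} xp i =
    subst (λ l → x (l + toℕ i) ≡ lookup (σ p) i) (imageLength-odd k below xa) (fixedPoint-image fix (suc (k * 2)) xp i)

  paired-quarter : ∀ k → PairedBelow k → Paired k → ∀ s → s < 4 → Paired (s + k * 4)
  paired-quarter k below (xa , _) 0 _ = (σa 0F at solve (k ∷ [])) , inj₂ (σa 1F at solve (k ∷ []))
    where σa = σa-at-8k k below xa
  paired-quarter k below (xa , _) 1 _ = (σa 2F at solve (k ∷ [])) , inj₁ (σa 3F at solve (k ∷ []))
    where σa = σa-at-8k k below xa
  paired-quarter k below (xa , inj₁ xb) 2 _ = (σa 4F at solve (k ∷ [])) , inj₁ (σp 0F at solve (k ∷ []))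
    where σa = σa-at-8k k below xa
          σp = σp-at-8k+5 k below xa xb
  paired-quarter k below (xa , inj₂ xc) 2 _ = (σa 4F at solve (k ∷ [])) , inj₂ (σp 0F at solve (k ∷ []))
    where σa = σa-at-8k k below xa
          σp = σp-at-8k+5 k below xa xc
  paired-quarter k below (xa , inj₁ xb) 3 _ = (σp 1F at solve (k ∷ [])) , inj₂ (σp 2F at solve (k ∷ []))
    where σp = σp-at-8k+5 k below xa xb
  paired-quarter k below (xa , inj₂ xc) 3 _ = (σp 1F at solve (k ∷ [])) , inj₁ (σp 2F at solve (k ∷ []))
    where σp = σp-at-8k+5 k below xa xc
  paired-quarter k _ _ (suc (suc (suc (suc _)))) (s≤s (s≤s (s≤s (s≤s ()))))

  paired : ∀ j → Paired j
  paired = <-rec Paired step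
    where
    step : ∀ n → PairedBelow n → Paired n
    step zero      _     = x0≡a , inj₂ (σa-at-8k 0 (λ ()) x0≡a 1F)
    step n@(suc _) below =
      subst Paired (sym (m≡m%n+[m/n]*n n 4))
        (paired-quarter (n / 4) (λ j<k → below (<-trans j<k k<n)) (below k<n) (n % 4) (m%n<n n 4))
      where
      k<n : n / 4 < n
      k<n = m/n<m n 4 (s≤s (s≤s z≤n))

  pairedBelow : ∀ k → PairedBelow k
  pairedBelow _ {j} _ = paired j

  x-4i+1-4i+3-parity : ∀ k s → s < 2 → x (suc ((s + k * 2) * 2 * 2)) ≡ ρ₁ (x (s + k * 2))
                         × x (suc (suc ((s + k * 2) * 2) * 2)) ≡ ρ₃ (x (s + k * 2))
  x-4i+1-4i+3-parity k 0 _ with paired k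
  ... | xa , _ rewrite xa = (σa 1F at solve (k ∷ [])) , (σa 3F at solve (k ∷ []))
    where σa = σa-at-8k k (pairedBelow k) xa
  x-4i+1-4i+3-parity k 1 _ with paired k
  ... | xa , inj₁ xb rewrite xb = (σp 0F at solve (k ∷ [])) , (σp 2F at solve (k ∷ []))
    where σp = σp-at-8k+5 k (pairedBelow k) xa xb
  ... | xa , inj₂ xc rewrite xc = (σp 0F at solve (k ∷ [])) , (σp 2F at solve (k ∷ []))
    where σp = σp-at-8k+5 k (pairedBelow k) xa xc
  x-4i+1-4i+3-parity k (suc (suc _)) (s≤s (s≤s ()))

  x-4i+1-4i+3 : ∀ i → x (suc (i * 2 * 2)) ≡ ρ₁ (x i) × x (suc (suc (i * 2) * 2)) ≡ ρ₃ (x i)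
  x-4i+1-4i+3 = ∀-by-residue 2 x-4i+1-4i+3-parity

  pairAt : ℕ → Letter × Letter
  pairAt i = x i , x (suc (i * 2))

  pairAt-recurrence : DigitRecurrence 2 pairStep pairAt
  pairAt-recurrence = digitRecurrence λ where
    i 0F → trans (cong pairAt (+-identityʳ (i * 2))) (cong₂ _,_ (proj₁ (paired i)) (proj₁ (x-4i+1-4i+3 i)))
    i 1F → trans (cong pairAt (+-comm (i * 2) 1)) (cong (x (suc (i * 2)) ,_) (proj₂ (x-4i+1-4i+3 i)))

mainTheorem3 : (x : ℕ → Letter) → IsFixedPoint σ x → x 0 ≡ a →
    IsAutomatic 4 x × IsAutomatic 2 x
mainTheorem3 x fix x0≡a =
  isAutomatic (digitRecurrence-square pairAt-recurrence) , isAutomatic pairAt-recurrence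
  where
  open FixedPointOfσ fix x0≡a using (pairAt; pairAt-recurrence)

  isAutomatic : ∀ {q δ} → DigitRecurrence q δ pairAt → IsAutomatic q x
  isAutomatic rec =
    digitRecurrence⇒isAutomatic encodePair decodePair decodePair-encodePair rec proj₁ (λ _ → refl)
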